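{- Let $\Gamma$ be an environment, $A$ a simple type and $M$ a good metaterm of $\lambda^{\to}_{\mathfrak m}$ such that $\mathrm{ver}_A(M^{\Gamma}) \twoheadrightarrow \star$. Then the $\beta$-normal form $M^{\downarrow}$ of $M$ is a term of the simply typed $\lambda$-calculus such that $\Gamma \vdash M^{\downarrow} : A$.
   Context: Simple types: $A,B ::= \mathbf{a} \mid A \Rightarrow B$, where $\mathbf{a}$ ranges over a denumerable set of atomic types. Terms: $t ::= x \mid \lambda x.t \mid t\,s$. An environment $\Gamma$ is a finite set $\{x_1:A_1,\dots,x_n:A_n\}$ of assignments to distinct variables. Typing is given by the usual rules: $\Gamma, x:A \vdash x:A$; from $\Gamma,x:A \vdash t:B$ infer $\Gamma \vdash \lambda x.t : A \Rightarrow B$; from $\Gamma\vdash t:A\Rightarrow B$ and $\Gamma \vdash s:A$ infer $\Gamma\vdash t\,s:B$. The metacalculus $\lambda^{\to}_{\mathfrak m}$ has metaterms $M,N ::= x \mid \lambda x.M \mid M\,N \mid \star \mid (M \triangleright N) \mid \mathrm{gen}_{\mathbf{a}} \mid \mathrm{ver}_{\mathbf{a}}(M)$ for atomic types $\mathbf{a}$ ($\star$ is a constant, $(M\triangleright N)$ is the guard). For arbitrary types: $\mathrm{gen}_{A\Rightarrow B} := \lambda x.(\mathrm{ver}_A(x) \triangleright \mathrm{gen}_B)$ ($x$ fresh) and $\mathrm{ver}_{A \Rightarrow B}(M) := \mathrm{ver}_B(M\,\mathrm{gen}_A)$. Reduction $\to$ is the closure under arbitrary contexts of $(\lambda x.M)\,N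 \to M\{x:=N\}$, $(\star \triangleright M) \to M$, $\mathrm{ver}_{\mathbf{a}}(\mathrm{gen}_{\mathbf{a}}) \to \star$; $\twoheadrightarrow$ is its reflexive-transitive closure. A metaterm is pure if it is built only from variables, abstractions and applications (pure metaterms are identified with terms); it is good if it is pure and $\beta$-normalizing (has a $\beta$-normal form). $M^{\Gamma}$ denotes $M$ with each free occurrence of each variable $x$ with $x:A\in\Gamma$ replaced by $\mathrm{gen}_A$ (other variables unchanged). -}

module Defs where

open import Data.Nat using (ℕ; zero; suc; _∸_; _<?_; _≟_)
open import Data.Product using (_×_; _,_; proj₁; ∃)
open import Data.List using (List; []; _∷_; map)
open import Data.Maybe using (Maybe; just; nothing)
open import Data.List.Membership.Propositional using (_∈_)
open import Data.List.Relation.Unary.Unique.Propositional using (Unique)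
open import Relation.Nullary using (¬_; yes; no)
open import Relation.Binary.Construct.Closure.ReflexiveTransitive using (Star)

infixr 7 _⇒_
data Ty : Set where
  atom : ℕ → Ty
  _⇒_  : Ty → Ty → Ty

-- Metaterms of the metacalculus, with variables as de Bruijn indices.
-- Pure metaterms (var, lam, app only) are the terms of the λ-calculus.
data MTm : Set where
  var   : ℕ → MTm
  lam   : MTm → MTm
  app   : MTm → MTm → MTm
  star  : MTm
  guard : MTm → MTm → MTm
  gen   : ℕ → MTm
  ver   : ℕ → MTm → MTm

data Pure : MTm → Set where
  var : ∀ x → Pure (var x)
  lam : ∀ {M} → Pure M → Pure (lam M)
  app : ∀ {M N} → Pure M → Pure N → Pure (app M N)

-- gen_A and ver_A for arbitrary types (gen_B is closed, so no shifting needed).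
mutual
  genT : Ty → MTm
  genT (atom a) = gen a
  genT (A ⇒ B)  = lam (guard (verT A (var 0)) (genT B))

  verT : Ty → MTm → MTm
  verT (atom a) M = ver a M
  verT (A ⇒ B)  M = verT B (app M (genT A))

ext : (ℕ → ℕ) → ℕ → ℕ
ext ρ zero    = zero
ext ρ (suc n) = suc (ρ n)

rename : (ℕ → ℕ) → MTm → MTm
rename ρ (var x)     = var (ρ x)
rename ρ (lam M)     = lam (rename (ext ρ) M)
rename ρ (app M N)   = app (rename ρ M) (rename ρ N)
rename ρ star        = star
rename ρ (guard M N) = guard (rename ρ M) (rename ρ N)
rename ρ (gen a)     = gen a
rename ρ (ver a M)   = ver a (rename ρ M)

exts : (ℕ → MTm) → ℕ → MTm
exts σ zero    = var zero
exts σ (suc n) = rename suc (σ n)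

subst : (ℕ → MTm) → MTm → MTm
subst σ (var x)     = σ x
subst σ (lam M)     = lam (subst (exts σ) M)
subst σ (app M N)   = app (subst σ M) (subst σ N)
subst σ star        = star
subst σ (guard M N) = guard (subst σ M) (subst σ N)
subst σ (gen a)     = gen a
subst σ (ver a M)   = ver a (subst σ M)

single : MTm → ℕ → MTm
single N zero    = N
single N (suc n) = var n

_[_] : MTm → MTm → MTm
M [ N ] = subst (single N) M

infix 4 _⟶_ _↠_
data _⟶_ : MTm → MTm → Set where
  β       : ∀ {M N} → app (lam M) N ⟶ M [ N ]
  guard★  : ∀ {M} → guard star M ⟶ M
  vergen  : ∀ {a} → ver a (gen a) ⟶ star
  ξ-lam   : ∀ {M M'} → M ⟶ M' → lam M ⟶ lam M'
  ξ-appˡ  : ∀ {M M' N} → M ⟶ M' → app M N ⟶ app M' N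
  ξ-appʳ  : ∀ {M N N'} → N ⟶ N' → app M N ⟶ app M N'
  ξ-guardˡ : ∀ {M M' N} → M ⟶ M' → guard M N ⟶ guard M' N
  ξ-guardʳ : ∀ {M N N'} → N ⟶ N' → guard M N ⟶ guard M N'
  ξ-ver   : ∀ {a M M'} → M ⟶ M' → ver a M ⟶ ver a M'

_↠_ : MTm → MTm → Set
_↠_ = Star _⟶_

Normal : MTm → Set
Normal M = ∀ N → ¬ (M ⟶ N)

-- good = pure and β-normalizing (on pure metaterms, ⟶ is exactly β).
Good : MTm → Set
Good M = Pure M × ∃ λ N → (M ↠ N) × Normal N

Env : Set
Env = List (ℕ × Ty)

Distinct : Env → Set
Distinct Γ = Unique (map proj₁ Γ)

lookupEnv : Env → ℕ → Maybe Ty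
lookupEnv []            x = nothing
lookupEnv ((y , A) ∷ Γ) x with x ≟ y
... | yes _ = just A
... | no  _ = lookupEnv Γ x

_,,_ : Env → Ty → Env
Γ ,, A = (zero , A) ∷ map (λ { (x , B) → (suc x , B) }) Γ

infix 3 _⊢_∶_
data _⊢_∶_ : Env → MTm → Ty → Set where
  ⊢var : ∀ {Γ x A} → (x , A) ∈ Γ → Γ ⊢ var x ∶ A
  ⊢lam : ∀ {Γ M A B} → (Γ ,, A) ⊢ M ∶ B → Γ ⊢ lam M ∶ A ⇒ B
  ⊢app : ∀ {Γ M N A B} → Γ ⊢ M ∶ A ⇒ B → Γ ⊢ N ∶ A → Γ ⊢ app M N ∶ B

-- M^Γ : replace each free occurrence of x with x:A ∈ Γ by gen_A
-- (d = number of binders passed).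
instAt : Env → ℕ → MTm → MTm
instAt Γ d (var i) with i <? d
... | yes _ = var i
... | no  _ with lookupEnv Γ (i ∸ d)
...   | just A  = genT A
...   | nothing = var i
instAt Γ d (lam M)     = lam (instAt Γ (suc d) M)
instAt Γ d (app M N)   = app (instAt Γ d M) (instAt Γ d N)
instAt Γ d star        = star
instAt Γ d (guard M N) = guard (instAt Γ d M) (instAt Γ d N)
instAt Γ d (gen a)     = gen a
instAt Γ d (ver a M)   = ver a (instAt Γ d M)

_^_ : MTm → Env → MTm
M ^ Γ = instAt Γ zero M

-- Write M^Γ as a substitution sending each x : A of Γ to gen_A.  The metacalculus
-- is confluent (Takahashi's parallel reduction) and ★ is normal, so ver_A(N^Γ) ↠ ★
-- also holds for the β-normal form N, whose type is then read off by induction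
-- on N.  At an arrow type, ver_{B⇒C}((λx.N')^Γ) feeds gen_B to x, which just
-- extends the substitution.  For a neutral N = x N₁ … N_k with x : D in Γ and
-- A = A₁ ⇒ … ⇒ A_m ⇒ c, the test is ver_c(gen_D N₁^Γ … N_k^Γ gen_{A₁} … gen_{A_m}).
-- Each argument of gen_D is consumed by a guard ver_{D_i}(_), and a guard in head
-- position disappears only once its condition has reached ★, while ver_c of a λ,
-- of a variable-headed spine or of gen_d with d ≠ c is stuck.  Hence
-- D = D₁ ⇒ … ⇒ D_{k+m} ⇒ c with ver_{D_i}(N_i^Γ) ↠ ★, which types N_i by
-- induction, and ver_{D_{k+i}}(gen_{A_i}) ↠ ★, which forces D_{k+i} = A_i.

module Submission where

open import Defs
open import Data.Empty using (⊥-elim)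
open import Data.List using (List; []; _∷_; map)
open import Data.List.Membership.Propositional using (_∈_)
open import Data.List.Membership.Propositional.Properties using (∈-map⁺)
open import Data.List.Relation.Unary.Any using (here; there)
open import Data.List.Relation.Binary.Pointwise as Pointwise using (Pointwise; []; _∷_)
open import Data.Maybe using (just; nothing)
open import Data.Nat using (ℕ; zero; suc; _≟_; _<?_; _∸_; s≤s; z≤n; s≤s⁻¹)
open import Data.Product using (_×_; _,_; ∃)
open import Function using (_∘_; case_of_)
open import Relation.Binary.PropositionalEquality
  using (_≡_; _≢_; _≗_; refl; sym; trans; cong; cong₂; module ≡-Reasoning)
  renaming (subst to transport)
open import Relation.Binary.Construct.Closure.ReflexiveTransitive as Star
  using (Star; ε; _◅_; _◅◅_; return; _⋆)
open import Relation.Binary.Rewriting using (Confluent)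
open import Relation.Nullary using (¬_; yes; no)

-- Substitution lemmas

ext-cong : ∀ {ρ ρ'} → ρ ≗ ρ' → ext ρ ≗ ext ρ'
ext-cong e zero    = refl
ext-cong e (suc x) = cong suc (e x)

rename-cong : ∀ {ρ ρ'} → ρ ≗ ρ' → ∀ M → rename ρ M ≡ rename ρ' M
rename-cong e (var x)     = cong var (e x)
rename-cong e (lam M)     = cong lam (rename-cong (ext-cong e) M)
rename-cong e (app M N)   = cong₂ app (rename-cong e M) (rename-cong e N)
rename-cong e star        = refl
rename-cong e (guard M N) = cong₂ guard (rename-cong e M) (rename-cong e N)
rename-cong e (gen a)     = refl
rename-cong e (ver a M)   = cong (ver a) (rename-cong e M)

exts-cong : ∀ {σ τ} → σ ≗ τ → exts σ ≗ exts τ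
exts-cong e zero    = refl
exts-cong e (suc x) = cong (rename suc) (e x)

subst-cong : ∀ {σ τ} → σ ≗ τ → ∀ M → subst σ M ≡ subst τ M
subst-cong e (var x)     = e x
subst-cong e (lam M)     = cong lam (subst-cong (exts-cong e) M)
subst-cong e (app M N)   = cong₂ app (subst-cong e M) (subst-cong e N)
subst-cong e star        = refl
subst-cong e (guard M N) = cong₂ guard (subst-cong e M) (subst-cong e N)
subst-cong e (gen a)     = refl
subst-cong e (ver a M)   = cong (ver a) (subst-cong e M)

rename-∘ : ∀ ρ ρ' M → rename ρ (rename ρ' M) ≡ rename (ρ ∘ ρ') M
rename-∘ ρ ρ' (var x)     = refl
rename-∘ ρ ρ' (lam M)     = cong lam (trans (rename-∘ (ext ρ) (ext ρ') M) (rename-cong ext-∘ M))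
  where
  ext-∘ : ext ρ ∘ ext ρ' ≗ ext (ρ ∘ ρ')
  ext-∘ zero    = refl
  ext-∘ (suc x) = refl
rename-∘ ρ ρ' (app M N)   = cong₂ app (rename-∘ ρ ρ' M) (rename-∘ ρ ρ' N)
rename-∘ ρ ρ' star        = refl
rename-∘ ρ ρ' (guard M N) = cong₂ guard (rename-∘ ρ ρ' M) (rename-∘ ρ ρ' N)
rename-∘ ρ ρ' (gen a)     = refl
rename-∘ ρ ρ' (ver a M)   = cong (ver a) (rename-∘ ρ ρ' M)

subst-rename : ∀ σ ρ M → subst σ (rename ρ M) ≡ subst (σ ∘ ρ) M
subst-rename σ ρ (var x)     = refl
subst-rename σ ρ (lam M)     = cong lam (trans (subst-rename (exts σ) (ext ρ) M) (subst-cong exts-ext M))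
  where
  exts-ext : exts σ ∘ ext ρ ≗ exts (σ ∘ ρ)
  exts-ext zero    = refl
  exts-ext (suc x) = refl
subst-rename σ ρ (app M N)   = cong₂ app (subst-rename σ ρ M) (subst-rename σ ρ N)
subst-rename σ ρ star        = refl
subst-rename σ ρ (guard M N) = cong₂ guard (subst-rename σ ρ M) (subst-rename σ ρ N)
subst-rename σ ρ (gen a)     = refl
subst-rename σ ρ (ver a M)   = cong (ver a) (subst-rename σ ρ M)

rename-subst : ∀ ρ σ M → rename ρ (subst σ M) ≡ subst (rename ρ ∘ σ) M
rename-subst ρ σ (var x)     = refl
rename-subst ρ σ (lam M)     = cong lam (trans (rename-subst (ext ρ) (exts σ) M) (subst-cong ext-exts M))
  where
  ext-exts : rename (ext ρ) ∘ exts σ ≗ exts (rename ρ ∘ σ)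
  ext-exts zero    = refl
  ext-exts (suc x) = trans (rename-∘ (ext ρ) suc (σ x)) (sym (rename-∘ suc ρ (σ x)))
rename-subst ρ σ (app M N)   = cong₂ app (rename-subst ρ σ M) (rename-subst ρ σ N)
rename-subst ρ σ star        = refl
rename-subst ρ σ (guard M N) = cong₂ guard (rename-subst ρ σ M) (rename-subst ρ σ N)
rename-subst ρ σ (gen a)     = refl
rename-subst ρ σ (ver a M)   = cong (ver a) (rename-subst ρ σ M)

subst-∘ : ∀ τ σ M → subst τ (subst σ M) ≡ subst (subst τ ∘ σ) M
subst-∘ τ σ (var x)     = refl
subst-∘ τ σ (lam M)     = cong lam (trans (subst-∘ (exts τ) (exts σ) M) (subst-cong exts-∘ M))
  where
  exts-∘ : subst (exts τ) ∘ exts σ ≗ exts (subst τ ∘ σ)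
  exts-∘ zero    = refl
  exts-∘ (suc x) = trans (subst-rename (exts τ) suc (σ x)) (sym (rename-subst suc τ (σ x)))
subst-∘ τ σ (app M N)   = cong₂ app (subst-∘ τ σ M) (subst-∘ τ σ N)
subst-∘ τ σ star        = refl
subst-∘ τ σ (guard M N) = cong₂ guard (subst-∘ τ σ M) (subst-∘ τ σ N)
subst-∘ τ σ (gen a)     = refl
subst-∘ τ σ (ver a M)   = cong (ver a) (subst-∘ τ σ M)

subst-var : ∀ M → subst var M ≡ M
subst-var (var x)     = refl
subst-var (lam M)     = cong lam (trans (subst-cong exts-var M) (subst-var M))
  where
  exts-var : exts var ≗ var
  exts-var zero    = refl
  exts-var (suc x) = refl
subst-var (app M N)   = cong₂ app (subst-var M) (subst-var N)
subst-var star        = refl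
subst-var (guard M N) = cong₂ guard (subst-var M) (subst-var N)
subst-var (gen a)     = refl
subst-var (ver a M)   = cong (ver a) (subst-var M)

weaken-[] : ∀ N M → rename suc M [ N ] ≡ M
weaken-[] N M = trans (subst-rename (single N) suc M) (subst-var M)

subst-[] : ∀ σ M N → subst σ (M [ N ]) ≡ subst (exts σ) M [ subst σ N ]
subst-[] σ M N = begin
  subst σ (M [ N ])                                ≡⟨ subst-∘ σ (single N) M ⟩
  subst (subst σ ∘ single N) M                     ≡⟨ subst-cong single-exts M ⟩
  subst (subst (single (subst σ N)) ∘ exts σ) M    ≡⟨ sym (subst-∘ (single (subst σ N)) (exts σ) M) ⟩
  subst (exts σ) M [ subst σ N ]                   ∎
  where
  open ≡-Reasoning
  single-exts : subst σ ∘ single N ≗ subst (single (subst σ N)) ∘ exts σ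
  single-exts zero    = refl
  single-exts (suc x) = sym (weaken-[] (subst σ N) (σ x))

rename-[] : ∀ ρ M N → rename ρ (M [ N ]) ≡ rename (ext ρ) M [ rename ρ N ]
rename-[] ρ M N = begin
  rename ρ (M [ N ])                         ≡⟨ rename-subst ρ (single N) M ⟩
  subst (rename ρ ∘ single N) M              ≡⟨ subst-cong single-ext M ⟩
  subst (single (rename ρ N) ∘ ext ρ) M      ≡⟨ sym (subst-rename (single (rename ρ N)) (ext ρ) M) ⟩
  rename (ext ρ) M [ rename ρ N ]            ∎
  where
  open ≡-Reasoning
  single-ext : rename ρ ∘ single N ≗ single (rename ρ N) ∘ ext ρ
  single-ext zero    = refl
  single-ext (suc x) = refl

mutual
  rename-genT : ∀ ρ A → rename ρ (genT A) ≡ genT A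
  rename-genT ρ (atom a) = refl
  rename-genT ρ (A ⇒ B)  =
    cong lam (cong₂ guard (rename-verT (ext ρ) A (var 0)) (rename-genT (ext ρ) B))

  rename-verT : ∀ ρ A M → rename ρ (verT A M) ≡ verT A (rename ρ M)
  rename-verT ρ (atom a) M = refl
  rename-verT ρ (A ⇒ B)  M =
    trans (rename-verT ρ B (app M (genT A))) (cong (λ Z → verT B (app (rename ρ M) Z)) (rename-genT ρ A))

mutual
  subst-genT : ∀ σ A → subst σ (genT A) ≡ genT A
  subst-genT σ (atom a) = refl
  subst-genT σ (A ⇒ B)  =
    cong lam (cong₂ guard (subst-verT (exts σ) A (var 0)) (subst-genT (exts σ) B))

  subst-verT : ∀ σ A M → subst σ (verT A M) ≡ verT A (subst σ M)
  subst-verT σ (atom a) M = refl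
  subst-verT σ (A ⇒ B)  M =
    trans (subst-verT σ B (app M (genT A))) (cong (λ Z → verT B (app (subst σ M) Z)) (subst-genT σ A))

-- Confluence

lam-↠ : ∀ {M M'} → M ↠ M' → lam M ↠ lam M'
lam-↠ = Star.gmap lam ξ-lam

appˡ-↠ : ∀ {M M' N} → M ↠ M' → app M N ↠ app M' N
appˡ-↠ {N = N} = Star.gmap (λ M → app M N) ξ-appˡ

appʳ-↠ : ∀ {M N N'} → N ↠ N' → app M N ↠ app M N'
appʳ-↠ {M = M} = Star.gmap (app M) ξ-appʳ

guardˡ-↠ : ∀ {M M' N} → M ↠ M' → guard M N ↠ guard M' N
guardˡ-↠ {N = N} = Star.gmap (λ M → guard M N) ξ-guardˡ

guardʳ-↠ : ∀ {M N N'} → N ↠ N' → guard M N ↠ guard M N'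
guardʳ-↠ {M = M} = Star.gmap (guard M) ξ-guardʳ

ver-↠ : ∀ {a M M'} → M ↠ M' → ver a M ↠ ver a M'
ver-↠ {a} = Star.gmap (ver a) ξ-ver

verT-↠ : ∀ A {M M'} → M ↠ M' → verT A M ↠ verT A M'
verT-↠ (atom a) r = ver-↠ r
verT-↠ (A ⇒ B)  r = verT-↠ B (appˡ-↠ r)

infix 4 _⇛_ _⇛*_
data _⇛_ : MTm → MTm → Set where
  pvar    : ∀ {x} → var x ⇛ var x
  plam    : ∀ {M M'} → M ⇛ M' → lam M ⇛ lam M'
  papp    : ∀ {M M' N N'} → M ⇛ M' → N ⇛ N' → app M N ⇛ app M' N'
  pβ      : ∀ {M M' N N'} → M ⇛ M' → N ⇛ N' → app (lam M) N ⇛ M' [ N' ]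
  pstar   : star ⇛ star
  pguard  : ∀ {M M' N N'} → M ⇛ M' → N ⇛ N' → guard M N ⇛ guard M' N'
  pguard★ : ∀ {N N'} → N ⇛ N' → guard star N ⇛ N'
  pgen    : ∀ {a} → gen a ⇛ gen a
  pver    : ∀ {a M M'} → M ⇛ M' → ver a M ⇛ ver a M'
  pvergen : ∀ {a} → ver a (gen a) ⇛ star

_⇛*_ : MTm → MTm → Set
_⇛*_ = Star _⇛_

⇛-refl : ∀ M → M ⇛ M
⇛-refl (var x)     = pvar
⇛-refl (lam M)     = plam (⇛-refl M)
⇛-refl (app M N)   = papp (⇛-refl M) (⇛-refl N)
⇛-refl star        = pstar
⇛-refl (guard M N) = pguard (⇛-refl M) (⇛-refl N)
⇛-refl (gen a)     = pgen
⇛-refl (ver a M)   = pver (⇛-refl M)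

⟶⇒⇛ : ∀ {M N} → M ⟶ N → M ⇛ N
⟶⇒⇛ β            = pβ (⇛-refl _) (⇛-refl _)
⟶⇒⇛ guard★       = pguard★ (⇛-refl _)
⟶⇒⇛ vergen       = pvergen
⟶⇒⇛ (ξ-lam s)    = plam (⟶⇒⇛ s)
⟶⇒⇛ (ξ-appˡ s)   = papp (⟶⇒⇛ s) (⇛-refl _)
⟶⇒⇛ (ξ-appʳ s)   = papp (⇛-refl _) (⟶⇒⇛ s)
⟶⇒⇛ (ξ-guardˡ s) = pguard (⟶⇒⇛ s) (⇛-refl _)
⟶⇒⇛ (ξ-guardʳ s) = pguard (⇛-refl _) (⟶⇒⇛ s)
⟶⇒⇛ (ξ-ver s)    = pver (⟶⇒⇛ s)

⇛⇒↠ : ∀ {M N} → M ⇛ N → M ↠ N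
⇛⇒↠ pvar         = ε
⇛⇒↠ (plam p)     = lam-↠ (⇛⇒↠ p)
⇛⇒↠ (papp p q)   = appˡ-↠ (⇛⇒↠ p) ◅◅ appʳ-↠ (⇛⇒↠ q)
⇛⇒↠ (pβ p q)     = appˡ-↠ (lam-↠ (⇛⇒↠ p)) ◅◅ appʳ-↠ (⇛⇒↠ q) ◅◅ return β
⇛⇒↠ pstar        = ε
⇛⇒↠ (pguard p q) = guardˡ-↠ (⇛⇒↠ p) ◅◅ guardʳ-↠ (⇛⇒↠ q)
⇛⇒↠ (pguard★ p)  = guard★ ◅ ⇛⇒↠ p
⇛⇒↠ pgen         = ε
⇛⇒↠ (pver p)     = ver-↠ (⇛⇒↠ p)
⇛⇒↠ pvergen      = return vergen

⇛-rename : ∀ ρ {M M'} → M ⇛ M' → rename ρ M ⇛ rename ρ M'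
⇛-rename ρ pvar         = pvar
⇛-rename ρ (plam p)     = plam (⇛-rename (ext ρ) p)
⇛-rename ρ (papp p q)   = papp (⇛-rename ρ p) (⇛-rename ρ q)
⇛-rename ρ (pβ {M' = M'} {N' = N'} p q) =
  transport (_ ⇛_) (sym (rename-[] ρ M' N')) (pβ (⇛-rename (ext ρ) p) (⇛-rename ρ q))
⇛-rename ρ pstar        = pstar
⇛-rename ρ (pguard p q) = pguard (⇛-rename ρ p) (⇛-rename ρ q)
⇛-rename ρ (pguard★ p)  = pguard★ (⇛-rename ρ p)
⇛-rename ρ pgen         = pgen
⇛-rename ρ (pver p)     = pver (⇛-rename ρ p)
⇛-rename ρ pvergen      = pvergen

⇛-exts : ∀ {σ τ} → (∀ x → σ x ⇛ τ x) → ∀ x → exts σ x ⇛ exts τ x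
⇛-exts σ⇛τ zero    = pvar
⇛-exts σ⇛τ (suc x) = ⇛-rename suc (σ⇛τ x)

⇛-subst : ∀ {σ τ} → (∀ x → σ x ⇛ τ x) → ∀ {M M'} → M ⇛ M' → subst σ M ⇛ subst τ M'
⇛-subst σ⇛τ pvar         = σ⇛τ _
⇛-subst σ⇛τ (plam p)     = plam (⇛-subst (⇛-exts σ⇛τ) p)
⇛-subst σ⇛τ (papp p q)   = papp (⇛-subst σ⇛τ p) (⇛-subst σ⇛τ q)
⇛-subst {τ = τ} σ⇛τ (pβ {M' = M'} {N' = N'} p q) =
  transport (_ ⇛_) (sym (subst-[] τ M' N')) (pβ (⇛-subst (⇛-exts σ⇛τ) p) (⇛-subst σ⇛τ q))
⇛-subst σ⇛τ pstar        = pstar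
⇛-subst σ⇛τ (pguard p q) = pguard (⇛-subst σ⇛τ p) (⇛-subst σ⇛τ q)
⇛-subst σ⇛τ (pguard★ p)  = pguard★ (⇛-subst σ⇛τ p)
⇛-subst σ⇛τ pgen         = pgen
⇛-subst σ⇛τ (pver p)     = pver (⇛-subst σ⇛τ p)
⇛-subst σ⇛τ pvergen      = pvergen

⇛-[] : ∀ {M M' N N'} → M ⇛ M' → N ⇛ N' → M [ N ] ⇛ M' [ N' ]
⇛-[] {N = N} {N'} M⇛M' N⇛N' = ⇛-subst single⇛ M⇛M'
  where
  single⇛ : ∀ x → single N x ⇛ single N' x
  single⇛ zero    = N⇛N'
  single⇛ (suc x) = pvar

dev : MTm → MTm
dev (var x)           = var x
dev (lam M)           = lam (dev M)
dev (app (lam M) N)   = dev M [ dev N ]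
dev (app M N)         = app (dev M) (dev N)
dev star              = star
dev (guard star N)    = dev N
dev (guard M N)       = guard (dev M) (dev N)
dev (gen a)           = gen a
dev (ver a (gen b)) with a ≟ b
... | yes _ = star
... | no  _ = ver a (gen b)
dev (ver a M)         = ver a (dev M)

mutual
  ⇛-dev : ∀ {M N} → M ⇛ N → N ⇛ dev M
  ⇛-dev pvar         = pvar
  ⇛-dev (plam p)     = plam (⇛-dev p)
  ⇛-dev (papp p q)   = ⇛-dev-app p q
  ⇛-dev (pβ p q)     = ⇛-[] (⇛-dev p) (⇛-dev q)
  ⇛-dev pstar        = pstar
  ⇛-dev (pguard p q) = ⇛-dev-guard p q
  ⇛-dev (pguard★ p)  = ⇛-dev p
  ⇛-dev pgen         = pgen
  ⇛-dev (pver p)     = ⇛-dev-ver p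
  ⇛-dev (pvergen {a}) with a ≟ a
  ... | yes _   = pstar
  ... | no  a≢a = ⊥-elim (a≢a refl)

  ⇛-dev-app : ∀ {M M' N N'} → M ⇛ M' → N ⇛ N' → app M' N' ⇛ dev (app M N)
  ⇛-dev-app (plam p)       q = pβ (⇛-dev p) (⇛-dev q)
  ⇛-dev-app p@pvar         q = papp (⇛-dev p) (⇛-dev q)
  ⇛-dev-app p@(papp _ _)   q = papp (⇛-dev p) (⇛-dev q)
  ⇛-dev-app p@(pβ _ _)     q = papp (⇛-dev p) (⇛-dev q)
  ⇛-dev-app p@pstar        q = papp (⇛-dev p) (⇛-dev q)
  ⇛-dev-app p@(pguard _ _) q = papp (⇛-dev p) (⇛-dev q)
  ⇛-dev-app p@(pguard★ _)  q = papp (⇛-dev p) (⇛-dev q)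
  ⇛-dev-app p@pgen         q = papp (⇛-dev p) (⇛-dev q)
  ⇛-dev-app p@(pver _)     q = papp (⇛-dev p) (⇛-dev q)
  ⇛-dev-app p@pvergen      q = papp (⇛-dev p) (⇛-dev q)

  ⇛-dev-guard : ∀ {M M' N N'} → M ⇛ M' → N ⇛ N' → guard M' N' ⇛ dev (guard M N)
  ⇛-dev-guard pstar          q = pguard★ (⇛-dev q)
  ⇛-dev-guard p@pvar         q = pguard (⇛-dev p) (⇛-dev q)
  ⇛-dev-guard p@(plam _)     q = pguard (⇛-dev p) (⇛-dev q)
  ⇛-dev-guard p@(papp _ _)   q = pguard (⇛-dev p) (⇛-dev q)
  ⇛-dev-guard p@(pβ _ _)     q = pguard (⇛-dev p) (⇛-dev q)
  ⇛-dev-guard p@(pguard _ _) q = pguard (⇛-dev p) (⇛-dev q)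
  ⇛-dev-guard p@(pguard★ _)  q = pguard (⇛-dev p) (⇛-dev q)
  ⇛-dev-guard p@pgen         q = pguard (⇛-dev p) (⇛-dev q)
  ⇛-dev-guard p@(pver _)     q = pguard (⇛-dev p) (⇛-dev q)
  ⇛-dev-guard p@pvergen      q = pguard (⇛-dev p) (⇛-dev q)

  ⇛-dev-ver : ∀ {a M M'} → M ⇛ M' → ver a M' ⇛ dev (ver a M)
  ⇛-dev-ver {a} (pgen {b}) with a ≟ b
  ... | yes refl = pvergen
  ... | no  _    = pver pgen
  ⇛-dev-ver p@pvar         = pver (⇛-dev p)
  ⇛-dev-ver p@(plam _)     = pver (⇛-dev p)
  ⇛-dev-ver p@(papp _ _)   = pver (⇛-dev p)
  ⇛-dev-ver p@(pβ _ _)     = pver (⇛-dev p)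
  ⇛-dev-ver p@pstar        = pver (⇛-dev p)
  ⇛-dev-ver p@(pguard _ _) = pver (⇛-dev p)
  ⇛-dev-ver p@(pguard★ _)  = pver (⇛-dev p)
  ⇛-dev-ver p@(pver _)     = pver (⇛-dev p)
  ⇛-dev-ver p@pvergen      = pver (⇛-dev p)

⇛-strip : ∀ {M N M'} → M ⇛ N → M ⇛* M' → ∃ λ W → N ⇛* W × M' ⇛ W
⇛-strip M⇛N ε = _ , ε , M⇛N
⇛-strip M⇛N (M⇛M₁ ◅ M₁⇛*M') with ⇛-strip (⇛-dev M⇛M₁) M₁⇛*M'
... | W , devM⇛*W , M'⇛W = W , ⇛-dev M⇛N ◅ devM⇛*W , M'⇛W

⇛-confluent : Confluent _⇛_
⇛-confluent ε M⇛*M' = _ , M⇛*M' , ε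
⇛-confluent (M⇛N ◅ N⇛*N') M⇛*M' with ⇛-strip M⇛N M⇛*M'
... | W , N⇛*W , M'⇛W with ⇛-confluent N⇛*N' N⇛*W
...   | V , N'⇛*V , W⇛*V = V , N'⇛*V , M'⇛W ◅ W⇛*V

confluent : Confluent _⟶_
confluent M↠N M↠M' with ⇛-confluent (Star.map ⟶⇒⇛ M↠N) (Star.map ⟶⇒⇛ M↠M')
... | W , N⇛*W , M'⇛*W = W , (⇛⇒↠ ⋆) N⇛*W , (⇛⇒↠ ⋆) M'⇛*W

↠★-preserved : ∀ {M N} → M ↠ star → M ↠ N → N ↠ star
↠★-preserved M↠★ M↠N with confluent M↠★ M↠N
... | _ , ε     , N↠★ = N↠★
... | _ , () ◅ _ , _

subst-↠ : ∀ σ {M N} → M ↠ N → subst σ M ↠ subst σ N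
subst-↠ σ = Star.kleisliStar (subst σ) (⇛⇒↠ ∘ ⇛-subst (⇛-refl ∘ σ) ∘ ⟶⇒⇛)

-- Applicative spines and stuck terms

app* : MTm → List MTm → MTm
app* H []       = H
app* H (X ∷ xs) = app* (app H X) xs

app*-↠ : ∀ {H H' xs xs'} → H ↠ H' → Pointwise _↠_ xs xs' → app* H xs ↠ app* H' xs'
app*-↠ H↠H' []             = H↠H'
app*-↠ H↠H' (X↠X' ∷ xs↠xs') = app*-↠ (appˡ-↠ H↠H' ◅◅ appʳ-↠ X↠X') xs↠xs'

app*-≡gen : ∀ {H c} xs → app* H xs ≡ gen c → H ≡ gen c
app*-≡gen []       e = e
app*-≡gen (X ∷ xs) e with app*-≡gen xs e
... | ()

NotLam : MTm → Set
NotLam H = ∀ {M} → H ≢ lam M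

data SpineStep (H : MTm) (xs : List MTm) : MTm → Set where
  head : ∀ {H'} → H ⟶ H' → SpineStep H xs (app* H' xs)
  args : ∀ {xs'} → Pointwise _↠_ xs xs' → SpineStep H xs (app* H xs')

spine-step : ∀ {H W} xs → NotLam H → app* H xs ⟶ W → SpineStep H xs W
spine-step []       _      s = head s
spine-step (X ∷ xs) H≢lam s with spine-step xs (λ ()) s
... | args xs↠xs'    = args (ε ∷ xs↠xs')
... | head β         = ⊥-elim (H≢lam refl)
... | head (ξ-appˡ t) = head t
... | head (ξ-appʳ t) = args (return t ∷ Pointwise.refl ε)

data VerStep (c : ℕ) (M : MTm) : MTm → Set where
  fire   : M ≡ gen c → VerStep c M star
  inside : ∀ {M'} → M ⟶ M' → VerStep c M (ver c M')

ver-step : ∀ {c M W} → ver c M ⟶ W → VerStep c M W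
ver-step vergen    = fire refl
ver-step (ξ-ver s) = inside s

guard-spine-↠★ : ∀ {c P G} xs → ver c (app* (guard P G) xs) ↠ star →
  P ↠ star × ver c (app* G xs) ↠ star
guard-spine-↠★ xs = from-residual {xs = xs} ε ε (Pointwise.refl ε)
  where
  -- Follows the reduction to ★: until the guard fires, the reduct keeps this shape.
  from-residual : ∀ {c P P' G G' xs xs'} → P ↠ P' → G ↠ G' → Pointwise _↠_ xs xs' →
    ver c (app* (guard P' G') xs') ↠ star → P ↠ star × ver c (app* G xs) ↠ star
  from-residual {xs' = xs'} P↠P' G↠G' xs↠xs' (s ◅ s*) with ver-step s
  ... | fire e = case app*-≡gen xs' e of λ ()
  ... | inside s' with spine-step xs' (λ ()) s'
  ...   | args xs'↠xs''     = from-residual P↠P' G↠G' (Pointwise.transitive _◅◅_ xs↠xs' xs'↠xs'') s*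
  ...   | head guard★       = P↠P' , ver-↠ (app*-↠ G↠G' xs↠xs') ◅◅ s*
  ...   | head (ξ-guardˡ t) = from-residual (P↠P' ◅◅ return t) G↠G' xs↠xs' s*
  ...   | head (ξ-guardʳ t) = from-residual P↠P' (G↠G' ◅◅ return t) xs↠xs' s*

data Rigid : MTm → Set where
  var     : ∀ {j} → Rigid (var j)
  gen-app : ∀ {d X} → Rigid (app (gen d) X)
  app     : ∀ {M X} → Rigid M → Rigid (app M X)

data Stuck : MTm → Set where
  ver-rigid : ∀ {c M} → Rigid M → Stuck (ver c M)
  ver-lam   : ∀ {c M} → Stuck (ver c (lam M))
  ver-gen   : ∀ {c d} → d ≢ c → Stuck (ver c (gen d))

rigid-app* : ∀ {M} xs → Rigid M → Rigid (app* M xs)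
rigid-app* []       r = r
rigid-app* (X ∷ xs) r = rigid-app* xs (app r)

rigid-⟶ : ∀ {M M'} → Rigid M → M ⟶ M' → Rigid M'
rigid-⟶ gen-app (ξ-appʳ s) = gen-app
rigid-⟶ (app r) (ξ-appˡ s) = app (rigid-⟶ r s)
rigid-⟶ (app r) (ξ-appʳ s) = app r
rigid-⟶ (app ()) β

stuck-⟶ : ∀ {M M'} → Stuck M → M ⟶ M' → Stuck M'
stuck-⟶ (ver-rigid r) (ξ-ver s)         = ver-rigid (rigid-⟶ r s)
stuck-⟶ (ver-rigid ()) vergen
stuck-⟶ ver-lam       (ξ-ver (ξ-lam s)) = ver-lam
stuck-⟶ (ver-gen c≢c) vergen            = ⊥-elim (c≢c refl)

stuck-↛★ : ∀ {M} → Stuck M → ¬ (M ↠ star)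
stuck-↛★ st (s ◅ s*) = stuck-↛★ (stuck-⟶ st s) s*

-- Verification against a type

infixr 7 _⇒*_
_⇒*_ : List Ty → Ty → Ty
[]       ⇒* B = B
(A ∷ As) ⇒* B = A ⇒ (As ⇒* B)

argTys : Ty → List Ty
argTys (atom a) = []
argTys (A ⇒ B)  = A ∷ argTys B

resultAtom : Ty → ℕ
resultAtom (atom a) = a
resultAtom (A ⇒ B)  = resultAtom B

argTys-⇒* : ∀ A → argTys A ⇒* atom (resultAtom A) ≡ A
argTys-⇒* (atom a) = refl
argTys-⇒* (A ⇒ B)  = cong (A ⇒_) (argTys-⇒* B)

Verified : Ty → MTm → Set
Verified A M = verT A M ↠ star

verT-spine : ∀ A M → verT A M ≡ ver (resultAtom A) (app* M (map genT (argTys A)))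
verT-spine (atom a) M = refl
verT-spine (A ⇒ B)  M = verT-spine B (app M (genT A))

verified-guard : ∀ T {P G} → Verified T (guard P G) → P ↠ star × Verified T G
verified-guard T {P} {G} h rewrite verT-spine T (guard P G) | verT-spine T G =
  guard-spine-↠★ (map genT (argTys T)) h

genT⇒-β : ∀ A B X → app (genT (A ⇒ B)) X ⟶ guard (verT A X) (genT B)
genT⇒-β A B X =
  transport (app (genT (A ⇒ B)) X ⟶_)
            (cong₂ guard (subst-verT (single X) A (var 0)) (subst-genT (single X) B)) β

gen-spine-↠★ : ∀ D c xs → ver c (app* (genT D) xs) ↠ star →
  ∃ λ Ts → D ≡ Ts ⇒* atom c × Pointwise Verified Ts xs
gen-spine-↠★ (atom d) c [] h with d ≟ c
... | yes refl = [] , refl , []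
... | no  d≢c  = ⊥-elim (stuck-↛★ (ver-gen d≢c) h)
gen-spine-↠★ (A ⇒ B) c [] h = ⊥-elim (stuck-↛★ ver-lam h)
gen-spine-↠★ (atom d) c (X ∷ xs) h = ⊥-elim (stuck-↛★ (ver-rigid (rigid-app* xs gen-app)) h)
gen-spine-↠★ (A ⇒ B) c (X ∷ xs) h
  with guard-spine-↠★ xs
         (↠★-preserved h (ver-↠ (app*-↠ {xs = xs} (return (genT⇒-β A B X)) (Pointwise.refl ε))))
... | verified-X , h' with gen-spine-↠★ B c xs h'
...   | Ts , refl , verified-xs = A ∷ Ts , refl , verified-X ∷ verified-xs

verified-genT : ∀ T B → Verified T (genT B) → T ≡ B
verified-genT (atom t) (atom b) h with b ≟ t
... | yes refl = refl
... | no  b≢t  = ⊥-elim (stuck-↛★ (ver-gen b≢t) h)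
verified-genT (atom t) (B₁ ⇒ B₂) h = ⊥-elim (stuck-↛★ ver-lam h)
verified-genT (T₁ ⇒ T₂) (atom b) h =
  ⊥-elim (stuck-↛★ (ver-rigid (rigid-app* (map genT (argTys T₂)) gen-app))
                   (transport (_↠ star) (verT-spine T₂ _) h))
verified-genT (T₁ ⇒ T₂) (B₁ ⇒ B₂) h
  with verified-guard T₂ (↠★-preserved h (verT-↠ T₂ (return (genT⇒-β B₁ B₂ (genT T₁)))))
... | B₁-verifies-T₁ , T₂-verifies-B₂ =
  cong₂ _⇒_ (sym (verified-genT B₁ T₁ B₁-verifies-T₁)) (verified-genT T₂ B₂ T₂-verifies-B₂)

verified-genTs : ∀ {Ts} As → Pointwise Verified Ts (map genT As) → Ts ≡ As
verified-genTs []       []       = refl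
verified-genTs (A ∷ As) (v ∷ vs) = cong₂ _∷_ (verified-genT _ A v) (verified-genTs As vs)

-- Typing normal forms

mutual
  data Nf : MTm → Set where
    lam : ∀ {M} → Nf M → Nf (lam M)
    ne  : ∀ {M} → Ne M → Nf M

  data Ne : MTm → Set where
    var : ∀ x → Ne (var x)
    app : ∀ {M N} → Ne M → Nf N → Ne (app M N)

-- The substitutions arising from M^Γ and from feeding generators to binders:
-- each variable becomes a generator of a type it is declared with, or a variable.
data Generic (Γ : Env) (i : ℕ) : MTm → Set where
  gen : ∀ {D} → (i , D) ∈ Γ → Generic Γ i (genT D)
  var : ∀ {j} → Generic Γ i (var j)

GenericSubst : Env → (ℕ → MTm) → Set
GenericSubst Γ σ = ∀ i → Generic Γ i (σ i)

genericSubst-,, : ∀ {Γ σ} B → GenericSubst Γ σ →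
  GenericSubst (Γ ,, B) (subst (single (genT B)) ∘ exts σ)
genericSubst-,, B g zero          = gen (here refl)
genericSubst-,, {Γ} {σ} B g (suc i) =
  transport (Generic (Γ ,, B) (suc i)) (sym (weaken-[] (genT B) (σ i))) (shift (g i))
  where
  shift : ∀ {M} → Generic Γ i M → Generic (Γ ,, B) (suc i) M
  shift (gen i∈Γ) = gen (there (∈-map⁺ _ i∈Γ))
  shift var       = var

mutual
  nf-typed : ∀ {Γ σ M} → Nf M → GenericSubst Γ σ → ∀ A → Verified A (subst σ M) → Γ ⊢ M ∶ A
  nf-typed (lam n) g (atom a) h = ⊥-elim (stuck-↛★ ver-lam h)
  nf-typed {σ = σ} {lam N} (lam n) g (B ⇒ C) h =
    ⊢lam (nf-typed n (genericSubst-,, B g) C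
      (transport (Verified C) (subst-∘ (single (genT B)) (exts σ) N)
                 (↠★-preserved h (verT-↠ C (return β)))))
  nf-typed {Γ} {σ} {M} (ne n) g A h
    with ne-typed n g (resultAtom A) (map genT (argTys A)) (transport (_↠ star) (verT-spine A _) h)
  ... | Ts , ⊢M , verified rewrite verified-genTs (argTys A) verified =
    transport (Γ ⊢ M ∶_) (argTys-⇒* A) ⊢M

  ne-typed : ∀ {Γ σ M} → Ne M → GenericSubst Γ σ → ∀ c xs → ver c (app* (subst σ M) xs) ↠ star →
    ∃ λ Ts → Γ ⊢ M ∶ Ts ⇒* atom c × Pointwise Verified Ts xs
  ne-typed {σ = σ} (var x) g c xs h with σ x | g x
  ... | _ | var = ⊥-elim (stuck-↛★ (ver-rigid (rigid-app* xs var)) h)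
  ... | _ | gen {D} x∈Γ with gen-spine-↠★ D c xs h
  ...   | Ts , refl , verified = Ts , ⊢var x∈Γ , verified
  ne-typed {σ = σ} (app {N = N} m n) g c xs h with ne-typed m g c (subst σ N ∷ xs) h
  ... | T ∷ Ts , ⊢M , verified-N ∷ verified = Ts , ⊢app ⊢M (nf-typed n g T verified-N) , verified

-- From the metaterm to its normal form

pure-rename : ∀ ρ {M} → Pure M → Pure (rename ρ M)
pure-rename ρ (var x)   = var _
pure-rename ρ (lam p)   = lam (pure-rename (ext ρ) p)
pure-rename ρ (app p q) = app (pure-rename ρ p) (pure-rename ρ q)

pure-subst : ∀ {σ} → (∀ x → Pure (σ x)) → ∀ {M} → Pure M → Pure (subst σ M)
pure-subst pure-σ (var x)   = pure-σ x
pure-subst pure-σ (lam p)   = lam (pure-subst pure-exts p)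
  where
  pure-exts : ∀ x → Pure (exts _ x)
  pure-exts zero    = var zero
  pure-exts (suc x) = pure-rename suc (pure-σ x)
pure-subst pure-σ (app p q) = app (pure-subst pure-σ p) (pure-subst pure-σ q)

pure-⟶ : ∀ {M N} → Pure M → M ⟶ N → Pure N
pure-⟶ (app (lam p) q) β = pure-subst pure-single p
  where
  pure-single : ∀ x → Pure (single _ x)
  pure-single zero    = q
  pure-single (suc x) = var x
pure-⟶ (lam p)   (ξ-lam s)  = lam (pure-⟶ p s)
pure-⟶ (app p q) (ξ-appˡ s) = app (pure-⟶ p s) q
pure-⟶ (app p q) (ξ-appʳ s) = app p (pure-⟶ q s)

pure-↠ : ∀ {M N} → Pure M → M ↠ N → Pure N
pure-↠ p ε        = p
pure-↠ p (s ◅ s*) = pure-↠ (pure-⟶ p s) s*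

pure-normal⇒nf : ∀ {M} → Pure M → Normal M → Nf M
pure-normal⇒nf (var x) _ = ne (var x)
pure-normal⇒nf (lam p) normal = lam (pure-normal⇒nf p (λ N s → normal (lam N) (ξ-lam s)))
pure-normal⇒nf {app M N} (app p q) normal
  with pure-normal⇒nf p (λ M' s → normal (app M' N) (ξ-appˡ s))
... | lam _ = ⊥-elim (normal _ β)
... | ne m  = ne (app m (pure-normal⇒nf q (λ N' s → normal (app M N') (ξ-appʳ s))))

instσ : Env → ℕ → ℕ → MTm
instσ Γ d i = instAt Γ d (var i)

instσ-suc : ∀ Γ d → instσ Γ (suc d) ≗ exts (instσ Γ d)
instσ-suc Γ d zero with 0 <? suc d
... | yes _   = refl
... | no  0≮d = ⊥-elim (0≮d (s≤s z≤n))
instσ-suc Γ d (suc i) with suc i <? suc d | i <? d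
... | yes _       | yes _   = refl
... | yes 1+i<1+d | no  i≮d = ⊥-elim (i≮d (s≤s⁻¹ 1+i<1+d))
... | no  1+i≮1+d | yes i<d = ⊥-elim (1+i≮1+d (s≤s i<d))
... | no  _       | no  _ with lookupEnv Γ (i ∸ d)
...   | just A  = sym (rename-genT suc A)
...   | nothing = refl

instAt≡subst : ∀ Γ d M → instAt Γ d M ≡ subst (instσ Γ d) M
instAt≡subst Γ d (var x)     = refl
instAt≡subst Γ d (lam M)     = cong lam (trans (instAt≡subst Γ (suc d) M) (subst-cong (instσ-suc Γ d) M))
instAt≡subst Γ d (app M N)   = cong₂ app (instAt≡subst Γ d M) (instAt≡subst Γ d N)
instAt≡subst Γ d star        = refl
instAt≡subst Γ d (guard M N) = cong₂ guard (instAt≡subst Γ d M) (instAt≡subst Γ d N)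
instAt≡subst Γ d (gen a)     = refl
instAt≡subst Γ d (ver a M)   = cong (ver a) (instAt≡subst Γ d M)

lookupEnv-∈ : ∀ Γ x {A} → lookupEnv Γ x ≡ just A → (x , A) ∈ Γ
lookupEnv-∈ ((y , B) ∷ Γ) x e with x ≟ y
lookupEnv-∈ ((y , B) ∷ Γ) x refl | yes refl = here refl
... | no _ = there (lookupEnv-∈ Γ x e)

instσ-generic : ∀ Γ → GenericSubst Γ (instσ Γ 0)
instσ-generic Γ i with i <? 0
... | no _ with lookupEnv Γ i in e
...   | just A  = gen (lookupEnv-∈ Γ i e)
...   | nothing = var

theorem3p14 : (Γ : Env) → Distinct Γ → (A : Ty) → (M : MTm) → Good M →
    verT A (M ^ Γ) ↠ star →
    (N : MTm) → M ↠ N → Normal N → Γ ⊢ N ∶ A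
theorem3p14 Γ _ A M (pure-M , _) verified-M N M↠N normal-N =
  nf-typed (pure-normal⇒nf (pure-↠ pure-M M↠N) normal-N) (instσ-generic Γ) A verified-N
  where
  verified-N : Verified A (subst (instσ Γ 0) N)
  verified-N = ↠★-preserved (transport (Verified A) (instAt≡subst Γ 0 M) verified-M)
                            (verT-↠ A (subst-↠ (instσ Γ 0) M↠N))
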